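{- Let $\mathcal H$ be a family of graphs. There exist constants $c_1=c_1(\mathcal H)$ and $c_2=c_2(\mathcal H)$ such that every $\mathcal H$-free graph $G$ has fewer than $c_2$ vertices $v$ with $\operatorname{sdeg}(v)\ge c_1$ if and only if $\mathcal H\le\{nK_{1,n},\ G_n\}$ for some positive integer $n$.
   Context: All graphs are finite, simple and undirected. For a vertex $v$ of $G$, $\operatorname{sdeg}(v)=c(G-v)-c(G)+1$, where $c(\cdot)$ is the number of connected components. For graphs $H_1,H_2$, write $H_1\prec H_2$ if $H_2$ contains an induced subgraph isomorphic to $H_1$. A graph $G$ is $\mathcal H$-free if no $H\in\mathcal H$ satisfies $H\prec G$. For families, $\mathcal H_1\le\mathcal H_2$ means for every $H_2\in\mathcal H_2$ there is $H_1\in\mathcal H_1$ with $H_1\prec H_2$. $nK_{1,n}$ is the disjoint union of $n$ copies of the star $K_{1,n}$; $G_n$ is the graph obtained from the complete graph $K_n$ by attaching $n$ new pendant vertices to each vertex of $K_n$. -}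

module Defs where

open import Data.Bool using (Bool; true; false; _∧_; _∨_; not; _xor_)
open import Data.Nat using (ℕ; zero; suc; _*_; _≡ᵇ_; _<ᵇ_; _≤_; _<_; _≤?_; _/_; _%_)
open import Data.Fin using (Fin; toℕ; punchIn)
open import Data.List using (List; length; filter; allFin)
open import Data.Bool.ListAction using (any; all)
open import Data.Product using (Σ; _×_; ∃)
open import Relation.Binary.PropositionalEquality using (_≡_; refl; cong₂)
open import Relation.Nullary using (¬_)
open import Function.Definitions using (Injective)

record Graph : Set where
  field
    V      : ℕ
    adj    : Fin V → Fin V → Bool
    sym    : ∀ i j → adj i j ≡ adj j i
    irrefl : ∀ i → adj i i ≡ false
open Graph public

_≺_ : Graph → Graph → Set
H ≺ G = Σ (Fin (V H) → Fin (V G)) λ f →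
          Injective _≡_ _≡_ f × (∀ i j → adj H i j ≡ adj G (f i) (f j))

Family : Set₁
Family = Graph → Set

_-free : Family → Graph → Set
(𝓗 -free) G = ∀ H → 𝓗 H → ¬ (H ≺ G)

_==ᶠ_ : ∀ {n} → Fin n → Fin n → Bool
i ==ᶠ j = toℕ i ≡ᵇ toℕ j

reach : (G : Graph) → ℕ → Fin (V G) → Fin (V G) → Bool
reach G zero    i j = i ==ᶠ j
reach G (suc k) i j =
  reach G k i j ∨ any (λ l → reach G k i l ∧ adj G l j) (allFin (V G))

-- i and j lie in the same component (a walk of length ≤ |V| suffices)
connected : (G : Graph) → Fin (V G) → Fin (V G) → Bool
connected G = reach G (V G)

isRep : (G : Graph) → Fin (V G) → Bool
isRep G i = all (λ j → not ((toℕ j <ᵇ toℕ i) ∧ connected G i j)) (allFin (V G))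

-- c(G): number of connected components (one least-index vertex per component)
c : Graph → ℕ
c G = length (filter (λ i → isRep G i Data.Bool.≟ true) (allFin (V G)))
  where import Data.Bool

delAux : (n : ℕ) (a : Fin n → Fin n → Bool) →
         (∀ i j → a i j ≡ a j i) → (∀ i → a i i ≡ false) → Fin n → Graph
delAux (suc m) a s r v = record
  { V = m
  ; adj = λ i j → a (punchIn v i) (punchIn v j)
  ; sym = λ i j → s (punchIn v i) (punchIn v j)
  ; irrefl = λ i → r (punchIn v i) }

_─_ : (G : Graph) → Fin (V G) → Graph
G ─ v = delAux (V G) (adj G) (sym G) (irrefl G) v

-- sdeg(v) = c(G - v) - c(G) + 1  (always ≥ 0, since c(G-v) ≥ c(G) - 1)
sdeg : (G : Graph) → Fin (V G) → ℕ
sdeg G v = suc (c (G ─ v)) Data.Nat.∸ c G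
  where import Data.Nat

#bigSdeg : (G : Graph) → ℕ → ℕ
#bigSdeg G k = length (filter (λ v → k ≤? sdeg G v) (allFin (V G)))

-- The graphs nK_{1,n} and G_n, on vertex set Fin (n * (n+1)).
-- Vertex x is read as the pair (x / (n+1), x % (n+1)) = (block, position);
-- position 0 is the centre of the block.

private
  ≡ᵇ-sym : ∀ m n → (m ≡ᵇ n) ≡ (n ≡ᵇ m)
  ≡ᵇ-sym zero zero = refl
  ≡ᵇ-sym zero (suc n) = refl
  ≡ᵇ-sym (suc m) zero = refl
  ≡ᵇ-sym (suc m) (suc n) = ≡ᵇ-sym m n

  ≡ᵇ-refl : ∀ m → (m ≡ᵇ m) ≡ true
  ≡ᵇ-refl zero = refl
  ≡ᵇ-refl (suc m) = ≡ᵇ-refl m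

  xor-comm : ∀ a b → (a xor b) ≡ (b xor a)
  xor-comm true true = refl
  xor-comm true false = refl
  xor-comm false true = refl
  xor-comm false false = refl

  xor-self : ∀ a → (a xor a) ≡ false
  xor-self true = refl
  xor-self false = refl

  ∧-comm : ∀ a b → (a ∧ b) ≡ (b ∧ a)
  ∧-comm true true = refl
  ∧-comm true false = refl
  ∧-comm false true = refl
  ∧-comm false false = refl

blk : (n : ℕ) → Fin (n * suc n) → ℕ
blk n x = toℕ x / suc n

pos : (n : ℕ) → Fin (n * suc n) → ℕ
pos n x = toℕ x % suc n

nK1n : ℕ → Graph
nK1n n = record
  { V = n * suc n
  ; adj = a
  ; sym = λ i j → cong₂ _∧_ (≡ᵇ-sym (blk n i) (blk n j))
                            (xor-comm (pos n i ≡ᵇ 0) (pos n j ≡ᵇ 0))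
  ; irrefl = λ i → cong₂ _∧_ (≡ᵇ-refl (blk n i)) (xor-self (pos n i ≡ᵇ 0)) }
  where
  a : Fin (n * suc n) → Fin (n * suc n) → Bool
  a i j = (blk n i ≡ᵇ blk n j) ∧ ((pos n i ≡ᵇ 0) xor (pos n j ≡ᵇ 0))

-- G_n: K_n (the centres) with n pendant vertices attached to each vertex
Gn : ℕ → Graph
Gn n = record
  { V = n * suc n
  ; adj = a
  ; sym = λ i j → cong₂ _∨_
            (cong₂ _∧_ (∧-comm (pos n i ≡ᵇ 0) (pos n j ≡ᵇ 0))
                       (cong not (≡ᵇ-sym (blk n i) (blk n j))))
            (cong₂ _∧_ (≡ᵇ-sym (blk n i) (blk n j))
                       (xor-comm (pos n i ≡ᵇ 0) (pos n j ≡ᵇ 0)))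
  ; irrefl = λ i → cong₂ _∨_ (cong₂ _∧_ {x = (pos n i ≡ᵇ 0) ∧ (pos n i ≡ᵇ 0)} refl
                                (cong not (≡ᵇ-refl (blk n i))) ⟨ trans ⟩ ∧-false _)
                             (cong₂ _∧_ (≡ᵇ-refl (blk n i)) (xor-self (pos n i ≡ᵇ 0))) }
  where
  open import Relation.Binary.PropositionalEquality using (cong; trans)
  open import Function using (_⟨_⟩_)
  ∧-false : ∀ b → (b ∧ false) ≡ false
  ∧-false true = refl
  ∧-false false = refl
  a : Fin (n * suc n) → Fin (n * suc n) → Bool
  a i j = (((pos n i ≡ᵇ 0) ∧ (pos n j ≡ᵇ 0)) ∧ not (blk n i ≡ᵇ blk n j))
        ∨ ((blk n i ≡ᵇ blk n j) ∧ ((pos n i ≡ᵇ 0) xor (pos n j ≡ᵇ 0)))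

_≤fam[_] : Family → ℕ → Set
𝓗 ≤fam[ n ] = (∃ λ H → 𝓗 H × H ≺ nK1n n) × (∃ λ H → 𝓗 H × H ≺ Gn n)

-- sdeg v is the number of components of G − v containing a neighbour of v, so sdeg v ≥ k iff v has k
-- neighbours that are pairwise separated by v. The N centres of nK_{1,N} and of G_N have sdeg N, so
-- constants c₁, c₂ force both graphs, for N = 1 + c₁ + c₂, to contain a member of 𝓗. Conversely, among
-- R(n, n) vertices of sdeg ≥ 2n Ramsey's theorem finds n forming a clique or an independent set. Each
-- such v keeps n neighbours in distinct components of G − v that contain none of the other n − 1, and
-- these n centres with their n neighbours each induce G_n or nK_{1,n}.

module Submission where

open import Defs hiding (sym)
open import Axiom.ExcludedMiddle using (ExcludedMiddle)
open import Data.Bool as Bool using (Bool; true; false; T; not; _∧_; _∨_; _xor_)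
open import Data.Bool.Properties using (T-≡; T-not-≡; T-∧; T-∨)
open import Data.Empty using (⊥; ⊥-elim)
open import Data.Fin as Fin using (Fin; zero; suc; toℕ; punchIn; punchOut; combine)
import Data.Fin.Properties as Finₚ
open import Data.List using (List; []; _∷_; length; filter; tabulate; allFin; map; lookup)
open import Data.List.Membership.Propositional using (lose)
open import Data.List.Membership.Propositional.Properties using (∈-allFin; ∈-lookup; ∈-tabulate⁺)
open import Data.List.Properties using (length-map; length-tabulate; filter-all; filter-accept; filter-reject)
import Data.List.Relation.Binary.Sublist.Propositional as Sublist
import Data.List.Relation.Binary.Sublist.Propositional.Properties as Sublistₚ
open import Data.List.Relation.Unary.All as All using (All; []; _∷_)
import Data.List.Relation.Unary.All.Properties as Allₚ
open import Data.List.Relation.Unary.AllPairs as AllPairs using (AllPairs; []; _∷_)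
import Data.List.Relation.Unary.AllPairs.Properties as AllPairsₚ
import Data.List.Relation.Unary.Any as Any
open import Data.List.Relation.Unary.Any.Properties using (any⁺; any⁻)
open import Data.List.Relation.Unary.Unique.Propositional using (Unique)
import Data.List.Relation.Unary.Unique.Propositional.Properties as Uniqueₚ
open import Data.Nat
  using (ℕ; zero; suc; _+_; _*_; _∸_; _≤_; _<_; z≤n; s≤s; _<ᵇ_; _≡ᵇ_; _/_; _%_; _≤′_; ≤′-refl; ≤′-step)
open import Data.Nat.DivMod using ([m+kn]%n≡m%n; m<n⇒m%n≡m; /-congˡ; +-distrib-/-∣ʳ; m<n⇒m/n≡0; m*n/n≡m)
open import Data.Nat.Divisibility using (divides-refl)
open import Data.Nat.Properties
open import Algebra.Properties.CommutativeMonoid.Sum +-0-commutativeMonoid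
  using (sum; sum-remove; ∑-distrib-+; sum-cong-≗)
open import Data.Product using (∃; ∃₂; _×_; _,_; proj₁; proj₂)
open import Data.Sum using (_⊎_; inj₁; inj₂; [_,_]′)
open import Function using (_∘_; id; case_of_)
open import Function.Bundles using (_⇔_; mk⇔; Equivalence)
open import Level using (0ℓ)
open import Relation.Binary using (Rel; Symmetric)
open import Relation.Binary.Construct.Closure.ReflexiveTransitive as Star using (Star; ε; _◅_; _◅◅_)
open import Relation.Binary.PropositionalEquality
open import Relation.Nullary using (¬_; yes; no; does; contradiction)
open import Relation.Unary using (Pred; Decidable; _⊆_; _∩_; ∁)

¬T⇒≡false : ∀ {b} → ¬ T b → b ≡ false
¬T⇒≡false {false} _  = refl
¬T⇒≡false {true}  ¬t = contradiction _ ¬t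

module _ {A : Set} {P : Pred A 0ℓ} {R : Rel A 0ℓ} where

  AllPairs-with-All : ∀ {xs} → All P xs → AllPairs R xs → AllPairs (λ x y → P x × P y × R x y) xs
  AllPairs-with-All []         []         = []
  AllPairs-with-All (px ∷ pxs) (rx ∷ rxs) =
    All.zipWith (λ (py , r) → px , py , r) (pxs , rx) ∷ AllPairs-with-All pxs rxs

AllPairs-resp-⊆ : ∀ {A : Set} {R : Rel A 0ℓ} {xs ys} → xs Sublist.⊆ ys → AllPairs R ys → AllPairs R xs
AllPairs-resp-⊆ Sublist.[]         []         = []
AllPairs-resp-⊆ (_ Sublist.∷ʳ τ)   (_ ∷ rys)  = AllPairs-resp-⊆ τ rys
AllPairs-resp-⊆ (refl Sublist.∷ τ) (ry ∷ rys) = Sublistₚ.All-resp-⊆ τ ry ∷ AllPairs-resp-⊆ τ rys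

length-filter-≟ : ∀ {A : Set} (f : A → Bool) xs →
                  length (filter (λ y → f y Bool.≟ true) xs) + length (filter (λ y → f y Bool.≟ false) xs)
                  ≡ length xs
length-filter-≟ f []       = refl
length-filter-≟ f (x ∷ xs) with f x
... | true  = cong suc (length-filter-≟ f xs)
... | false = trans (+-suc _ _) (cong suc (length-filter-≟ f xs))

module _ {A : Set} {R : Rel A 0ℓ} (R-sym : Symmetric R) where

  lookup-AllPairs : ∀ {xs} → AllPairs R xs → ∀ {i j} → i ≢ j → R (lookup xs i) (lookup xs j)
  lookup-AllPairs (rx ∷ _)  {zero}  {zero}  0≢0 = contradiction refl 0≢0
  lookup-AllPairs (rx ∷ _)  {zero}  {suc j} _   = All.lookup rx (∈-lookup j)
  lookup-AllPairs (rx ∷ _)  {suc i} {zero}  _   = R-sym (All.lookup rx (∈-lookup i))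
  lookup-AllPairs (_ ∷ rxs) {suc i} {suc j} i≢j = lookup-AllPairs rxs (i≢j ∘ cong suc)

  AllPairs⇒family : ∀ {P : Pred A 0ℓ} {n} xs → n ≤ length xs → All P xs → AllPairs R xs →
                    ∃ λ (f : Fin n → A) → (∀ i → P (f i)) × (∀ {i j} → i ≢ j → R (f i) (f j))
  AllPairs⇒family xs n≤∣xs∣ ps rs =
    (λ i → lookup xs (Fin.inject≤ i n≤∣xs∣)) ,
    (λ i → All.lookup ps (∈-lookup _)) ,
    (λ i≢j → lookup-AllPairs rs (i≢j ∘ Finₚ.inject≤-injective n≤∣xs∣ n≤∣xs∣ _ _))

ramseyBound : ℕ → ℕ → ℕ
ramseyBound zero    _       = 0
ramseyBound (suc _) zero    = 0
ramseyBound (suc a) (suc b) = suc (ramseyBound a (suc b) + ramseyBound (suc a) b)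

+-≤-split : ∀ {m n o p} → m + n ≤ o + p → m ≤ o ⊎ n ≤ p
+-≤-split {m} {n} {o} {p} m+n≤o+p with m ≤? o | n ≤? p
... | yes m≤o | _       = inj₁ m≤o
... | no _    | yes n≤p = inj₂ n≤p
... | no m≰o  | no n≰p  = contradiction m+n≤o+p (<⇒≱ (+-mono-< (≰⇒> m≰o) (≰⇒> n≰p)))

module _ {A : Set} (colour : A → A → Bool) where

  MonochromaticSublist : Bool → ℕ → List A → Set
  MonochromaticSublist κ k xs =
    ∃ λ ys → ys Sublist.⊆ xs × length ys ≡ k × AllPairs (λ x y → colour x y ≡ κ) ys

  private
    Coloured : Bool → A → List A → List A
    Coloured κ x = filter (λ y → colour x y Bool.≟ κ)

    extend : ∀ {κ k x xs} → MonochromaticSublist κ k (Coloured κ x xs) → MonochromaticSublist κ (suc k) (x ∷ xs)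
    extend {κ} {x = x} {xs} (ys , ys⊆ , refl , mono) =
      x ∷ ys , refl Sublist.∷ Sublist.⊆-trans ys⊆ (Sublistₚ.filter-⊆ _ xs) , refl ,
      Sublistₚ.All-resp-⊆ ys⊆ (Allₚ.all-filter (λ y → colour x y Bool.≟ κ) xs) ∷ mono

    skip : ∀ {κ κ′ k x xs} → MonochromaticSublist κ k (Coloured κ′ x xs) → MonochromaticSublist κ k (x ∷ xs)
    skip {x = x} {xs} (ys , ys⊆ , len , mono) =
      ys , x Sublist.∷ʳ Sublist.⊆-trans ys⊆ (Sublistₚ.filter-⊆ _ xs) , len , mono

  ramsey : ∀ a b xs → ramseyBound a b ≤ length xs →
           MonochromaticSublist true a xs ⊎ MonochromaticSublist false b xs
  ramsey zero    _       xs       _ = inj₁ ([] , Sublist.minimum xs , refl , [])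
  ramsey (suc a) zero    xs       _ = inj₂ ([] , Sublist.minimum xs , refl , [])
  ramsey (suc a) (suc b) (x ∷ xs) (s≤s bound)
    with +-≤-split (subst (ramseyBound a (suc b) + ramseyBound (suc a) b ≤_)
                          (sym (length-filter-≟ (colour x) xs)) bound)
  ... | inj₁ bound₁ = [ inj₁ ∘ extend , inj₂ ∘ skip ]′ (ramsey a (suc b) (Coloured true x xs) bound₁)
  ... | inj₂ bound₂ = [ inj₁ ∘ skip , inj₂ ∘ extend ]′ (ramsey (suc a) b (Coloured false x xs) bound₂)

module Counting (em : ExcludedMiddle 0ℓ) where

  χ : Set → ℕ
  χ P with em {P}
  ... | yes _ = 1
  ... | no  _ = 0

  χ-yes : {P : Set} → P → χ P ≡ 1
  χ-yes {P} p with em {P}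
  ... | yes _ = refl
  ... | no ¬p = contradiction p ¬p

  χ-no : {P : Set} → ¬ P → χ P ≡ 0
  χ-no {P} ¬p with em {P}
  ... | yes p = contradiction p ¬p
  ... | no _  = refl

  χ-mono : {P Q : Set} → (P → Q) → χ P ≤ χ Q
  χ-mono {P} P⇒Q with em {P}
  ... | yes p = ≤-reflexive (sym (χ-yes (P⇒Q p)))
  ... | no _  = z≤n

  χ≤1 : (P : Set) → χ P ≤ 1
  χ≤1 P with em {P}
  ... | yes _ = ≤-refl
  ... | no _  = z≤n

  χ-cong : {P Q : Set} → P ⇔ Q → χ P ≡ χ Q
  χ-cong P⇔Q = ≤-antisym (χ-mono (Equivalence.to P⇔Q)) (χ-mono (Equivalence.from P⇔Q))

  χ-split : (P Q : Set) → χ P ≡ χ (P × Q) + χ (P × ¬ Q)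
  χ-split P Q with em {P} | em {Q}
  ... | no ¬p | _     = sym (cong₂ _+_ (χ-no (¬p ∘ proj₁)) (χ-no (¬p ∘ proj₁)))
  ... | yes p | yes q = sym (cong₂ _+_ (χ-yes (p , q)) (χ-no (λ (_ , ¬q) → ¬q q)))
  ... | yes p | no ¬q = sym (cong₂ _+_ (χ-no (¬q ∘ proj₂)) (χ-yes (p , ¬q)))

  count : ∀ {n} → Pred (Fin n) 0ℓ → ℕ
  count P = sum (χ ∘ P)

  count-cong : ∀ {n} {P Q : Pred (Fin n) 0ℓ} → (∀ i → P i ⇔ Q i) → count P ≡ count Q
  count-cong P⇔Q = sum-cong-≗ (χ-cong ∘ P⇔Q)

  count-split : ∀ {n} (P C : Pred (Fin n) 0ℓ) → count P ≡ count (P ∩ C) + count (P ∩ ∁ C)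
  count-split P C = trans (sum-cong-≗ (λ i → χ-split (P i) (C i))) (∑-distrib-+ (χ ∘ (P ∩ C)) (χ ∘ (P ∩ ∁ C)))

  count-mono : ∀ {n} {P Q : Pred (Fin n) 0ℓ} → P ⊆ Q → count P ≤ count Q
  count-mono {zero}  P⊆Q = z≤n
  count-mono {suc n} {P} {Q} P⊆Q = +-mono-≤ (χ-mono P⊆Q) (count-mono {P = P ∘ suc} {Q ∘ suc} P⊆Q)

  count≤ : ∀ {n} (P : Pred (Fin n) 0ℓ) → count P ≤ n
  count≤ {zero}  P = z≤n
  count≤ {suc n} P = +-mono-≤ (χ≤1 (P zero)) (count≤ (P ∘ suc))

  count-remove : ∀ {n} (P : Pred (Fin (suc n)) 0ℓ) i → count P ≡ χ (P i) + count (P ∘ punchIn i)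
  count-remove P i = sum-remove {i = i} (χ ∘ P)

  count-∅ : ∀ {n} {P : Pred (Fin n) 0ℓ} → (∀ i → ¬ P i) → count P ≡ 0
  count-∅ {zero}  ¬P = refl
  count-∅ {suc n} ¬P = cong₂ _+_ (χ-no (¬P zero)) (count-∅ (¬P ∘ suc))

  count-singleton : ∀ {n} {P : Pred (Fin n) 0ℓ} {w} → P w → (∀ {i} → P i → i ≡ w) → count P ≡ 1
  count-singleton {suc n} {P} {w} Pw unique = begin
    count P                              ≡⟨ count-remove P w ⟩
    χ (P w) + count (P ∘ punchIn w)      ≡⟨ cong₂ _+_ (χ-yes Pw) (count-∅ λ i → Finₚ.punchInᵢ≢i w i ∘ unique) ⟩
    1                                    ∎
    where open ≡-Reasoning

  count-<-witness : ∀ {n} {P Q : Pred (Fin n) 0ℓ} {j} → P ⊆ Q → Q j → ¬ P j → count P < count Q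
  count-<-witness {suc n} {P} {Q} {j} P⊆Q Qj ¬Pj = begin-strict
    count P                              ≡⟨ count-remove P j ⟩
    χ (P j) + count (P ∘ punchIn j)      ≡⟨ cong (_+ count (P ∘ punchIn j)) (χ-no ¬Pj) ⟩
    count (P ∘ punchIn j)                <⟨ s≤s (count-mono {P = P ∘ punchIn j} {Q ∘ punchIn j} P⊆Q) ⟩
    1 + count (Q ∘ punchIn j)            ≡⟨ cong (_+ count (Q ∘ punchIn j)) (χ-yes Qj) ⟨
    χ (Q j) + count (Q ∘ punchIn j)      ≡⟨ count-remove Q j ⟨
    count Q                              ∎
    where open ≤-Reasoning

  count-strict-mono : ∀ {n} {P Q : Pred (Fin n) 0ℓ} → P ⊆ Q → ¬ (Q ⊆ P) → count P < count Q
  count-strict-mono {P = P} {Q} P⊆Q Q⊈P with em {∃ λ j → Q j × ¬ P j}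
  ... | yes (j , Qj , ¬Pj) = count-<-witness {P = P} {Q} P⊆Q Qj ¬Pj
  ... | no ∄j = ⊥-elim (Q⊈P Q⊆P)
    where
    Q⊆P : Q ⊆ P
    Q⊆P {j} Qj with em {P j}
    ... | yes Pj = Pj
    ... | no ¬Pj = contradiction (j , Qj , ¬Pj) ∄j

  length-filter-tabulate : ∀ {n} {A : Set} {P : Pred A 0ℓ} (P? : Decidable P) (f : Fin n → A) →
                           length (filter P? (tabulate f)) ≡ count (P ∘ f)
  length-filter-tabulate {zero}  P? f = refl
  length-filter-tabulate {suc n} P? f with P? (f zero)
  ... | yes p = cong₂ _+_ (sym (χ-yes p)) (length-filter-tabulate P? (f ∘ suc))
  ... | no ¬p = cong₂ _+_ (sym (χ-no ¬p)) (length-filter-tabulate P? (f ∘ suc))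

  disjoint-witnesses⇒length≤count :
    ∀ {n} {A : Set} {P : Pred (Fin n) 0ℓ} (R : A → Fin n → Set) {xs : List A} →
    All (λ x → ∃ λ i → P i × R x i) xs → AllPairs (λ x y → ∀ {i} → R x i → R y i → ⊥) xs →
    length xs ≤ count P
  disjoint-witnesses⇒length≤count R [] [] = z≤n
  disjoint-witnesses⇒length≤count {P = P} R {_ ∷ xs} ((i , Pi , Rxi) ∷ ws) (x-disjoint ∷ disjoint) = begin
    suc (length xs)                              ≤⟨ s≤s (disjoint-witnesses⇒length≤count R ws′ disjoint) ⟩
    1 + count (P ∩ ∁ (_≡ i))                     ≡⟨ cong (_+ count (P ∩ ∁ (_≡ i))) only-i ⟨
    count (P ∩ (_≡ i)) + count (P ∩ ∁ (_≡ i))   ≡⟨ count-split P (_≡ i) ⟨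
    count P                                      ∎
    where
    open ≤-Reasoning
    only-i : count (P ∩ (_≡ i)) ≡ 1
    only-i = count-singleton {P = P ∩ (_≡ i)} (Pi , refl) proj₂
    ws′ : All (λ y → ∃ λ j → (P ∩ ∁ (_≡ i)) j × R y j) xs
    ws′ = All.zipWith (λ ((j , Pj , Ryj) , y-disjoint) → j , (Pj , λ { refl → y-disjoint Rxi Ryj }) , Ryj)
                      (ws , x-disjoint)

  unique⇒length≤count : ∀ {n} {P : Pred (Fin n) 0ℓ} {xs} → Unique xs → All P xs → length xs ≤ count P
  unique⇒length≤count unique ps =
    disjoint-witnesses⇒length≤count _≡_ (All.map (λ Px → _ , Px , refl) ps)
                                        (AllPairs.map (λ x≢y → λ { refl refl → x≢y refl }) unique)

  module _ {A B : Set} (R : A → B → Set) {S : Rel A 0ℓ}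
           (disjoint : ∀ {x y t} → S x y → R x t → R y t → ⊥) where

    private
      misses? : ∀ t → Decidable λ y → ¬ R y t
      misses? t y = em

    length-filter-misses : ∀ t {ys} → AllPairs S ys → length ys ≤ suc (length (filter (misses? t) ys))
    length-filter-misses t {[]}     []         = z≤n
    length-filter-misses t {y ∷ ys} (sy ∷ sys) with em {R y t}
    ... | yes hit = ≤-reflexive (cong suc (begin
      length ys                             ≡⟨ cong length (filter-all (misses? t) others-miss) ⟨
      length (filter (misses? t) ys)        ≡⟨ cong length (filter-reject (misses? t) λ miss → miss hit) ⟨
      length (filter (misses? t) (y ∷ ys))  ∎))
      where
      open ≡-Reasoning
      others-miss : All (λ z → ¬ R z t) ys
      others-miss = All.map (λ s → disjoint s hit) sy
    ... | no miss = begin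
      suc (length ys)                               ≤⟨ s≤s (length-filter-misses t sys) ⟩
      suc (suc (length (filter (misses? t) ys)))    ≡⟨ cong (suc ∘ length) (filter-accept (misses? t) miss) ⟨
      suc (length (filter (misses? t) (y ∷ ys)))    ∎
      where open ≤-Reasoning

    keep-missing : ∀ {P : Pred A 0ℓ} ts xs → All P xs → AllPairs S xs →
                   ∃ λ ys → length xs ≤ length ts + length ys × All P ys × AllPairs S ys ×
                            All (λ y → All (¬_ ∘ R y) ts) ys
    keep-missing []       xs ps ss = xs , ≤-refl , ps , ss , All.map (λ _ → []) ps
    keep-missing (t ∷ ts) xs ps ss =
      let ys , bound , ps′ , ss′ , misses = keep-missing ts xs ps ss
      in  filter (misses? t) ys ,
          ≤-trans bound (≤-trans (+-monoʳ-≤ (length ts) (length-filter-misses t ss′))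
                                 (≤-reflexive (+-suc _ _))) ,
          Allₚ.filter⁺ (misses? t) ps′ ,
          AllPairsₚ.filter⁺ (misses? t) ss′ ,
          All.zipWith (λ (miss , misses) → miss ∷ misses)
                      (Allₚ.all-filter (misses? t) ys , Allₚ.filter⁺ (misses? t) misses)

module _ (G : Graph) where

  Edge : Rel (Fin (V G)) 0ℓ
  Edge x y = T (adj G x y)

  Edge-sym : Symmetric Edge
  Edge-sym {x} {y} = subst T (Graph.sym G x y)

  Edge-irrefl : ∀ {x y} → Edge x y → x ≢ y
  Edge-irrefl {x} e refl = subst T (Graph.irrefl G x) e

  Walk : Rel (Fin (V G)) 0ℓ
  Walk = Star Edge

  walk-reverse : ∀ {x y} → Walk x y → Walk y x
  walk-reverse = Star.reverse Edge-sym

  module _ (v : Fin (V G)) where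

    EdgeAvoiding : Rel (Fin (V G)) 0ℓ
    EdgeAvoiding x y = x ≢ v × Edge x y × y ≢ v

    WalkAvoiding : Rel (Fin (V G)) 0ℓ
    WalkAvoiding = Star EdgeAvoiding

    Separated : Rel (Fin (V G)) 0ℓ
    Separated x y = ¬ WalkAvoiding x y

    avoiding-reverse : ∀ {x y} → WalkAvoiding x y → WalkAvoiding y x
    avoiding-reverse = Star.reverse λ (x≢v , e , y≢v) → y≢v , Edge-sym e , x≢v

    avoiding⇒walk : ∀ {x y} → WalkAvoiding x y → Walk x y
    avoiding⇒walk = Star.map (proj₁ ∘ proj₂)

    walk-avoids : ∀ {x y} → Walk x y → ¬ Walk x v → WalkAvoiding x y
    walk-avoids ε                 x↛v = ε
    walk-avoids (_◅_ {j = z} e w) x↛v = (x≢v , e , z≢v) ◅ walk-avoids w (x↛v ∘ (e ◅_))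
      where
      x≢v : _ ≢ v
      x≢v refl = x↛v ε
      z≢v : z ≢ v
      z≢v refl = x↛v (e ◅ ε)

    walk⇒last-neighbour : ∀ {x} → Walk x v → x ≢ v → ∃ λ y → Edge y v × WalkAvoiding x y
    walk⇒last-neighbour ε                 x≢v = contradiction refl x≢v
    walk⇒last-neighbour (_◅_ {i = x} {j = z} e w) x≢v with z Fin.≟ v
    ... | yes refl = x , e , ε
    ... | no z≢v   = let y , e′ , w′ = walk⇒last-neighbour w z≢v in y , e′ , (x≢v , e , z≢v) ◅ w′

    pendant-separated : ∀ {x y} → (∀ {w} → Edge x w → w ≡ v) → WalkAvoiding x y → y ≡ x
    pendant-separated only-v ε                   = refl
    pendant-separated only-v ((_ , e , z≢v) ◅ _) = contradiction (only-v e) z≢v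

    separated⇒apart : ∀ {x y} → x ≢ v → y ≢ v → Separated x y → x ≢ y × adj G x y ≡ false
    separated⇒apart x≢v y≢v sep =
      (λ { refl → sep ε }) ,
      ¬T⇒≡false (λ e → sep ((x≢v , e , y≢v) ◅ ε))

≺-trans : ∀ {F G H} → F ≺ G → G ≺ H → F ≺ H
≺-trans (f , f-injective , f-adj) (g , g-injective , g-adj) =
  g ∘ f , f-injective ∘ g-injective , λ i j → trans (f-adj i j) (g-adj (f i) (f j))

-- G ─ v only computes once V G is a successor, hence the record patterns below.
lift : (G : Graph) (v : Fin (V G)) → Fin (V (G ─ v)) → Fin (V G)
lift record { V = suc _ } v = punchIn v

adj-lift : ∀ G v a b → adj (G ─ v) a b ≡ adj G (lift G v a) (lift G v b)
adj-lift record { V = suc _ } v a b = refl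

lift-injective : ∀ G v {a b} → lift G v a ≡ lift G v b → a ≡ b
lift-injective record { V = suc _ } v = Finₚ.punchIn-injective v _ _

lift≢ : ∀ G v a → lift G v a ≢ v
lift≢ record { V = suc _ } v = Finₚ.punchInᵢ≢i v

lift-surjective : ∀ G v {w} → w ≢ v → ∃ λ a → lift G v a ≡ w
lift-surjective record { V = suc _ } v w≢v = punchOut (w≢v ∘ sym) , Finₚ.punchIn-punchOut (w≢v ∘ sym)

lift-mono-≤ : ∀ G v {a b} → a Fin.≤ b → lift G v a Fin.≤ lift G v b
lift-mono-≤ record { V = suc _ } v = Finₚ.punchIn-mono-≤ v _ _

lift-cancel-≤ : ∀ G v {a b} → lift G v a Fin.≤ lift G v b → a Fin.≤ b
lift-cancel-≤ record { V = suc _ } v = Finₚ.punchIn-cancel-≤ v _ _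

module _ (G : Graph) (v : Fin (V G)) where

  lift-walk : ∀ {a b} → Walk (G ─ v) a b → WalkAvoiding G v (lift G v a) (lift G v b)
  lift-walk = Star.gmap (lift G v) λ {a} {b} e → lift≢ G v a , subst T (adj-lift G v a b) e , lift≢ G v b

  unlift-walk : ∀ {a b x y} → lift G v a ≡ x → lift G v b ≡ y → WalkAvoiding G v x y → Walk (G ─ v) a b
  unlift-walk {a} a↦x b↦x ε = subst (Walk (G ─ v) a) (lift-injective G v (trans a↦x (sym b↦x))) ε
  unlift-walk {a} a↦x b↦y (_◅_ {j = z} (_ , e , z≢v) w) =
    let c , c↦z = lift-surjective G v z≢v
    in  subst T (sym (adj-lift G v a c)) (subst₂ (λ s t → T (adj G s t)) (sym a↦x) (sym c↦z) e)
        ◅ unlift-walk c↦z b↦y w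

module Connectivity (em : ExcludedMiddle 0ℓ) where

  open Counting em

  ∃-least : ∀ {n} (P : Pred (Fin n) 0ℓ) {x} → P x → ∃ λ r → P r × ∀ {y} → P y → r Fin.≤ y
  ∃-least {suc n} P {x} Px with em {P zero} | x
  ... | yes P0 | _     = zero , P0 , λ _ → z≤n
  ... | no ¬P0 | zero  = contradiction Px ¬P0
  ... | no ¬P0 | suc x =
    let r , Pr , least = ∃-least (P ∘ suc) Px
    in  suc r , Pr , λ { {zero} P0 → contradiction P0 ¬P0 ; {suc y} Py → s≤s (least Py) }

  module _ (G : Graph) where

    -- A record rather than T (reach G k x y), so that k, x and y can be inferred.
    record Reach (k : ℕ) (x y : Fin (V G)) : Set where
      constructor mkReach
      field reached : T (reach G k x y)

    reach-zero : ∀ {x} → Reach 0 x x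
    reach-zero {x} = mkReach (≡⇒≡ᵇ (toℕ x) (toℕ x) refl)

    reach-zero⁻ : ∀ {x y} → Reach 0 x y → x ≡ y
    reach-zero⁻ (mkReach r) = Finₚ.toℕ-injective (≡ᵇ⇒≡ _ _ r)

    reach-step : ∀ {k x y} → Reach k x y → Reach (suc k) x y
    reach-step (mkReach r) = mkReach (Equivalence.from T-∨ (inj₁ r))

    reach-suc⁺ : ∀ {k x y z} → Reach k x z → Edge G z y → Reach (suc k) x y
    reach-suc⁺ {z = z} (mkReach r) e =
      mkReach (Equivalence.from T-∨ (inj₂ (any⁺ _ (lose (∈-allFin z) (Equivalence.from T-∧ (r , e))))))

    reach-suc⁻ : ∀ {k x y} → Reach (suc k) x y → Reach k x y ⊎ ∃ λ z → Reach k x z × Edge G z y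
    reach-suc⁻ {k} {x} {y} (mkReach r) with Equivalence.to T-∨ r
    ... | inj₁ r′ = inj₁ (mkReach r′)
    ... | inj₂ r′ =
      let z , r″ = Any.satisfied (any⁻ (λ z → reach G k x z ∧ adj G z y) (allFin (V G)) r′)
          r‴ , e = Equivalence.to T-∧ r″
      in  inj₂ (z , mkReach r‴ , e)

    reach-mono : ∀ {k l x y} → k ≤′ l → Reach k x y → Reach l x y
    reach-mono ≤′-refl        r = r
    reach-mono (≤′-step k≤l) r = reach-step (reach-mono k≤l r)

    reach⇒walk : ∀ k {x y} → Reach k x y → Walk G x y
    reach⇒walk zero    r = subst (Walk G _) (reach-zero⁻ r) ε
    reach⇒walk (suc k) r with reach-suc⁻ r
    ... | inj₁ r′           = reach⇒walk k r′
    ... | inj₂ (_ , r′ , e) = reach⇒walk k r′ ◅◅ (e ◅ ε)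

    walk⇒reach : ∀ {x y} → Walk G x y → ∃ λ k → Reach k x y
    walk⇒reach = extend reach-zero
      where
      extend : ∀ {k x y z} → Reach k x y → Walk G y z → ∃ λ l → Reach l x z
      extend r ε       = _ , r
      extend r (e ◅ w) = extend (reach-suc⁺ r e) w

    module _ (x : Fin (V G)) where

      Stable : ℕ → Set
      Stable t = ∀ {y} → Reach (suc t) x y → Reach t x y

      stable⇒saturated : ∀ {t} → Stable t → ∀ k {y} → Reach k x y → Reach t x y
      stable⇒saturated st zero    r = reach-mono (≤⇒≤′ z≤n) r
      stable⇒saturated st (suc k) r with reach-suc⁻ r
      ... | inj₁ r′           = stable⇒saturated st k r′
      ... | inj₂ (_ , r′ , e) = st (reach-suc⁺ (stable⇒saturated st k r′) e)

      -- Until it stabilises, the set of vertices within distance t of x gains a vertex at every step.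
      stable-or-growing : ∀ t → Stable t ⊎ t < count (Reach t x)
      stable-or-growing zero = inj₂ (unique⇒length≤count {P = Reach 0 x} ([] ∷ []) (reach-zero ∷ []))
      stable-or-growing (suc t) with em {Stable t} | stable-or-growing t
      ... | yes st | _          = inj₁ λ r → reach-step (stable⇒saturated st (suc (suc t)) r)
      ... | no ¬st | inj₁ st    = ⊥-elim (¬st st)
      ... | no ¬st | inj₂ t<#   =
        inj₂ (≤-trans (s≤s t<#) (count-strict-mono {P = Reach t x} {Reach (suc t) x} reach-step λ st → ¬st st))

      reach-saturates : ∀ {k y} → Reach k x y → Reach (V G) x y
      reach-saturates {k} with stable-or-growing (V G)
      ... | inj₁ st  = stable⇒saturated st k
      ... | inj₂ V<# = contradiction (count≤ (Reach (V G) x)) (<⇒≱ V<#)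

    connected⇔walk : ∀ {x y} → T (connected G x y) ⇔ Walk G x y
    connected⇔walk = mk⇔ (reach⇒walk (V G) ∘ mkReach)
                         λ w → let _ , r = walk⇒reach w in Reach.reached (reach-saturates _ r)

    IsRep : Pred (Fin (V G)) 0ℓ
    IsRep r = ∀ {y} → Walk G r y → r Fin.≤ y

    isRep⇔IsRep : ∀ {r} → T (isRep G r) ⇔ IsRep r
    isRep⇔IsRep {r} = mk⇔ to from
      where
      p : Fin (V G) → Bool
      p y = not ((toℕ y <ᵇ toℕ r) ∧ connected G r y)
      to : T (isRep G r) → IsRep r
      to t {y} w = ≮⇒≥ λ y<r →
        subst T (Equivalence.to T-not-≡ (All.lookup (Allₚ.all⁺ p (allFin (V G)) t) (∈-allFin y)))
                (Equivalence.from T-∧ (<⇒<ᵇ y<r , Equivalence.from connected⇔walk w))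
      from : IsRep r → T (isRep G r)
      from r-rep = Allₚ.all⁻ p {allFin (V G)} (All.tabulate λ {y} _ →
        Equivalence.from T-not-≡ (¬T⇒≡false λ t →
          let y<r , r~y = Equivalence.to T-∧ t
          in  <⇒≱ (<ᵇ⇒< (toℕ y) (toℕ r) y<r) (r-rep (Equivalence.to connected⇔walk r~y))))

    c≡count : c G ≡ count IsRep
    c≡count = trans (length-filter-tabulate (λ i → isRep G i Bool.≟ true) id)
                    (count-cong {P = λ i → isRep G i ≡ true} {IsRep} λ i →
                       mk⇔ (Equivalence.to isRep⇔IsRep ∘ Equivalence.from T-≡)
                           (Equivalence.to T-≡ ∘ Equivalence.from isRep⇔IsRep))

    representative : ∀ x → ∃ λ r → Walk G x r × IsRep r
    representative x =
      let r , x↝r , least = ∃-least (Walk G x) ε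
      in  r , x↝r , λ r↝y → least (x↝r ◅◅ r↝y)

    representative-unique : ∀ {r s} → IsRep r → IsRep s → Walk G r s → r ≡ s
    representative-unique r-rep s-rep w = Finₚ.≤-antisym (r-rep w) (s-rep (walk-reverse G w))

module CutVertex (em : ExcludedMiddle 0ℓ) where

  open Counting em
  open Connectivity em

  count-lift : ∀ G v (P : Pred (Fin (V G)) 0ℓ) → count P ≡ χ (P v) + count (P ∘ lift G v)
  count-lift record { V = suc _ } v P = count-remove P v

  module _ (G : Graph) (v : Fin (V G)) where

    private
      D : Graph
      D = G ─ v
      ↑ : Fin (V D) → Fin (V G)
      ↑ = lift G v

    AdjacentComponent : Pred (Fin (V D)) 0ℓ
    AdjacentComponent r = IsRep D r × Walk G (↑ r) v

    rep-lift⁻ : ∀ {u} → IsRep G (↑ u) → IsRep D u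
    rep-lift⁻ u-rep w = lift-cancel-≤ G v (u-rep (avoiding⇒walk G v (lift-walk G v w)))

    rep-lift⁺ : ∀ {u} → ¬ Walk G (↑ u) v → IsRep D u → IsRep G (↑ u)
    rep-lift⁺ {u} u↛v u-rep {y} w with y Fin.≟ v
    ... | yes refl = contradiction w u↛v
    ... | no y≢v   =
      let a , a↦y = lift-surjective G v y≢v
          u↝a     = unlift-walk G v refl a↦y (walk-avoids G v w u↛v)
      in  subst (↑ u Fin.≤_) a↦y (lift-mono-≤ G v (u-rep u↝a))

    -- The components of G are the one of v and those avoiding v (counted by Rest); the
    -- components of G − v are those avoiding v and those adjacent to v.
    sdeg≡count : sdeg G v ≡ count AdjacentComponent
    sdeg≡count = begin
      suc (c D) ∸ c G                                  ≡⟨ cong₂ (λ a b → suc a ∸ b) cD cG ⟩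
      suc (count AdjacentComponent + Rest) ∸ suc Rest  ≡⟨ m+n∸n≡m (count AdjacentComponent) Rest ⟩
      count AdjacentComponent                          ∎
      where
      open ≡-Reasoning
      ToV : Pred (Fin (V G)) 0ℓ
      ToV w = Walk G w v

      Rest : ℕ
      Rest = count (λ u → IsRep G (↑ u) × ¬ ToV (↑ u))

      v-component : count (IsRep G ∩ ToV) ≡ 1
      v-component =
        let r , v↝r , r-rep = representative G v
        in  count-singleton {P = IsRep G ∩ ToV} (r-rep , walk-reverse G v↝r)
              λ (s-rep , s↝v) → representative-unique G s-rep r-rep (s↝v ◅◅ v↝r)

      components-avoiding-v : count (IsRep D ∩ ∁ (ToV ∘ ↑)) ≡ Rest
      components-avoiding-v =
        count-cong {P = IsRep D ∩ ∁ (ToV ∘ ↑)} {λ u → IsRep G (↑ u) × ¬ ToV (↑ u)} λ u →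
          mk⇔ (λ (u-rep , u↛v) → rep-lift⁺ u↛v u-rep , u↛v) (λ (u-rep , u↛v) → rep-lift⁻ u-rep , u↛v)

      cG : c G ≡ suc Rest
      cG = begin
        c G
          ≡⟨ c≡count G ⟩
        count (IsRep G)
          ≡⟨ count-split (IsRep G) ToV ⟩
        count (IsRep G ∩ ToV) + count (IsRep G ∩ ∁ ToV)
          ≡⟨ cong₂ _+_ v-component (count-lift G v (IsRep G ∩ ∁ ToV)) ⟩
        1 + (χ (IsRep G v × ¬ ToV v) + Rest)
          ≡⟨ cong (λ n → 1 + (n + Rest)) (χ-no λ (_ , v↛v) → v↛v ε) ⟩
        suc Rest
          ∎

      cD : c D ≡ count AdjacentComponent + Rest
      cD = begin
        c D
          ≡⟨ c≡count D ⟩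
        count (IsRep D)
          ≡⟨ count-split (IsRep D) (ToV ∘ ↑) ⟩
        count AdjacentComponent + count (IsRep D ∩ ∁ (ToV ∘ ↑))
          ≡⟨ cong (count AdjacentComponent +_) components-avoiding-v ⟩
        count AdjacentComponent + Rest
          ∎

    separated-neighbours≤sdeg : ∀ {L} → All (Edge G v) L → AllPairs (Separated G v) L → length L ≤ sdeg G v
    separated-neighbours≤sdeg {L} adjacent separated =
      subst (length L ≤_) (sym sdeg≡count)
        (disjoint-witnesses⇒length≤count (λ x r → WalkAvoiding G v x (↑ r)) (All.map component adjacent)
          (AllPairs.map (λ x∤y {_} x↝r y↝r → x∤y (x↝r ◅◅ avoiding-reverse G v y↝r)) separated))
      where
      component : ∀ {x} → Edge G v x → ∃ λ r → AdjacentComponent r × WalkAvoiding G v x (↑ r)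
      component {x} e =
        let a , a↦x         = lift-surjective G v (Edge-irrefl G e ∘ sym)
            r , a↝r , r-rep = representative D a
            x↝r             = subst (λ z → WalkAvoiding G v z (↑ r)) a↦x (lift-walk G v a↝r)
        in  r , (r-rep , avoiding⇒walk G v (avoiding-reverse G v x↝r) ◅◅ (Edge-sym G e ◅ ε)) , x↝r

    separated-neighbours : ∃ λ L → length L ≡ sdeg G v × All (Edge G v) L × AllPairs (Separated G v) L
    separated-neighbours =
      map neighbour components ,
      trans (length-map neighbour components) (trans (length-filter-tabulate AC? id) (sym sdeg≡count)) ,
      Allₚ.map⁺ (All.map (proj₁ ∘ neighbour-spec) in-components) ,
      AllPairsₚ.map⁺ (AllPairs.map neighbours-separated
                       (AllPairs-with-All in-components (Uniqueₚ.filter⁺ AC? (Uniqueₚ.allFin⁺ (V D)))))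
      where
      AC? : Decidable AdjacentComponent
      AC? _ = em
      components : List (Fin (V D))
      components = filter AC? (allFin (V D))
      in-components : All AdjacentComponent components
      in-components = Allₚ.all-filter AC? (allFin (V D))

      -- v is a junk value: neighbour is only used on adjacent components.
      neighbour : Fin (V D) → Fin (V G)
      neighbour r with em {∃ λ y → Edge G y v × WalkAvoiding G v (↑ r) y}
      ... | yes (y , _) = y
      ... | no _        = v

      neighbour-spec : ∀ {r} → AdjacentComponent r →
                       Edge G v (neighbour r) × WalkAvoiding G v (↑ r) (neighbour r)
      neighbour-spec {r} (_ , r↝v) with em {∃ λ y → Edge G y v × WalkAvoiding G v (↑ r) y}
      ... | yes (_ , e , w) = Edge-sym G e , w
      ... | no ∄y           = contradiction (walk⇒last-neighbour G v r↝v (lift≢ G v r)) ∄y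

      neighbours-separated : ∀ {r s} → AdjacentComponent r × AdjacentComponent s × r ≢ s →
                             Separated G v (neighbour r) (neighbour s)
      neighbours-separated {r} {s} (r-comp@(r-rep , _) , s-comp@(s-rep , _) , r≢s) w =
        r≢s (representative-unique D r-rep s-rep (unlift-walk G v refl refl
          (proj₂ (neighbour-spec r-comp) ◅◅ w ◅◅ avoiding-reverse G v (proj₂ (neighbour-spec s-comp)))))

isCentre : ∀ {n} → Fin (suc n) → Bool
isCentre zero    = true
isCentre (suc _) = false

-- Adjacency of the vertices (i , q) and (j , r) of n stars K_{1,n}, where position 0 is the centre, in
-- terms of i = j, q = 0 and r = 0; centres of distinct stars are adjacent iff κ (nK_{1,n}: κ = false,
-- G_n: κ = true).
starsAdj : (κ sameStar : Bool) → Bool → Bool → Bool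
starsAdj κ true  c     c′    = c xor c′
starsAdj κ false true  true  = κ
starsAdj κ false _     _     = false

record Stars (G : Graph) (n : ℕ) : Set where
  field
    centre                      : Fin n → Fin (V G)
    leaf                        : Fin n → Fin n → Fin (V G)
    centre-injective            : ∀ {i j} → centre i ≡ centre j → i ≡ j
    centre-leaf                 : ∀ i p → Edge G (centre i) (leaf i p)
    leaves-separated            : ∀ i {p q} → p ≢ q → Separated G (centre i) (leaf i p) (leaf i q)
    leaf-separated-from-centres : ∀ i p j → Separated G (centre i) (leaf i p) (centre j)

  leaf≢centre : ∀ i p j → leaf i p ≢ centre j
  leaf≢centre i p j e = leaf-separated-from-centres i p j (subst (WalkAvoiding G (centre i) (leaf i p)) e ε)

  leaves-of-distinct-stars-separated : ∀ {i j} p q → i ≢ j → Separated G (centre i) (leaf i p) (leaf j q)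
  leaves-of-distinct-stars-separated {i} {j} p q i≢j w =
    leaf-separated-from-centres i p j
      (w ◅◅ (leaf≢centre j q i , Edge-sym G (centre-leaf j q) , i≢j ∘ centre-injective ∘ sym) ◅ ε)

  leaf-apart : ∀ i p {y} → y ≢ centre i → Separated G (centre i) (leaf i p) y →
              leaf i p ≢ y × adj G (leaf i p) y ≡ false
  leaf-apart i p y≢c = separated⇒apart G (centre i) (leaf≢centre i p i) y≢c

  place : Fin n → Fin (suc n) → Fin (V G)
  place i zero    = centre i
  place i (suc p) = leaf i p

  place-injective : ∀ {i j} q r → place i q ≡ place j r → i ≡ j × q ≡ r
  place-injective zero    zero    e = centre-injective e , refl
  place-injective zero    (suc r) e = contradiction (sym e) (leaf≢centre _ r _)
  place-injective (suc p) zero    e = contradiction e (leaf≢centre _ p _)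
  place-injective {i} {j} (suc p) (suc r) e with i Fin.≟ j
  ... | no i≢j   =
    contradiction e (proj₁ (leaf-apart i p (leaf≢centre j r i) (leaves-of-distinct-stars-separated p r i≢j)))
  ... | yes refl with p Fin.≟ r
  ...   | yes refl = refl , refl
  ...   | no p≢r   = contradiction e (proj₁ (leaf-apart i p (leaf≢centre i r i) (leaves-separated i p≢r)))

  module _ {κ : Bool} (centres-adj : ∀ {i j} → i ≢ j → adj G (centre i) (centre j) ≡ κ) where

    place-adj : ∀ i q j r →
                adj G (place i q) (place j r) ≡ starsAdj κ (does (i Fin.≟ j)) (isCentre q) (isCentre r)
    place-adj i zero j zero with i Fin.≟ j
    ... | yes refl = Graph.irrefl G (centre i)
    ... | no i≢j   = centres-adj i≢j
    place-adj i zero j (suc r) with i Fin.≟ j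
    ... | yes refl = Equivalence.to T-≡ (centre-leaf i r)
    ... | no i≢j   = trans (Graph.sym G (centre i) (leaf j r))
                           (proj₂ (leaf-apart j r (i≢j ∘ centre-injective) (leaf-separated-from-centres j r i)))
    place-adj i (suc p) j zero with i Fin.≟ j
    ... | yes refl = Equivalence.to T-≡ (Edge-sym G (centre-leaf i p))
    ... | no i≢j   = proj₂ (leaf-apart i p (i≢j ∘ centre-injective ∘ sym) (leaf-separated-from-centres i p j))
    place-adj i (suc p) j (suc r) with i Fin.≟ j
    ... | no i≢j   = proj₂ (leaf-apart i p (leaf≢centre j r i) (leaves-of-distinct-stars-separated p r i≢j))
    ... | yes refl with p Fin.≟ r
    ...   | yes refl = Graph.irrefl G (leaf i p)
    ...   | no p≢r   = proj₂ (leaf-apart i p (leaf≢centre i r i) (leaves-separated i p≢r))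

record StarsModel (κ : Bool) (n : ℕ) (M : Graph) : Set where
  field
    code           : Fin n → Fin (suc n) → Fin (V M)
    code-injective : ∀ {i j q r} → code i q ≡ code j r → i ≡ j × q ≡ r
    decode         : ∀ w → ∃₂ λ i q → code i q ≡ w
    adj-code       : ∀ i q j r →
                     adj M (code i q) (code j r) ≡ starsAdj κ (does (i Fin.≟ j)) (isCentre q) (isCentre r)

  private
    centre-leaf : ∀ i p → Edge M (code i zero) (code i (suc p))
    centre-leaf i p with i Fin.≟ i | adj-code i zero i (suc p)
    ... | yes _  | e = subst T (sym e) _
    ... | no i≢i | _ = contradiction refl i≢i

    leaf-pendant : ∀ {i p w} → Edge M (code i (suc p)) w → w ≡ code i zero
    leaf-pendant {i} {p} {w} e with decode w
    ... | j , r , refl with i Fin.≟ j | r | subst T (adj-code i (suc p) j r) e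
    ... | yes refl | zero  | _  = refl
    ... | yes refl | suc _ | ()
    ... | no _     | zero  | ()
    ... | no _     | suc _ | ()

  stars : Stars M n
  stars = record
    { centre                      = λ i → code i zero
    ; leaf                        = λ i p → code i (suc p)
    ; centre-injective            = proj₁ ∘ code-injective
    ; centre-leaf                 = centre-leaf
    ; leaves-separated            = λ i p≢q w →
        p≢q (Finₚ.suc-injective (proj₂ (code-injective (sym (pendant-separated M _ leaf-pendant w)))))
    ; leaf-separated-from-centres = λ i p j w →
        contradiction (proj₂ (code-injective (pendant-separated M _ leaf-pendant w))) λ ()
    }

  module _ {G : Graph} (σ : Stars G n)
           (centres-adj : ∀ {i j} → i ≢ j → adj G (Stars.centre σ i) (Stars.centre σ j) ≡ κ) where

    open Stars σ

    embed : Fin (V M) → Fin (V G)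
    embed w = let i , q , _ = decode w in place i q

    embed-injective : ∀ {w w′} → embed w ≡ embed w′ → w ≡ w′
    embed-injective {w} {w′} e =
      let i , q , iq↦w  = decode w
          j , r , jr↦w′ = decode w′
          i≡j , q≡r     = place-injective q r e
      in  trans (sym iq↦w) (trans (cong₂ code i≡j q≡r) jr↦w′)

    embed-adj : ∀ w w′ → adj M w w′ ≡ adj G (embed w) (embed w′)
    embed-adj w w′ =
      let i , q , iq↦w  = decode w
          j , r , jr↦w′ = decode w′
      in  begin
        adj M w w′                                                ≡⟨ cong₂ (adj M) (sym iq↦w) (sym jr↦w′) ⟩
        adj M (code i q) (code j r)                               ≡⟨ adj-code i q j r ⟩
        starsAdj κ (does (i Fin.≟ j)) (isCentre q) (isCentre r)  ≡⟨ place-adj centres-adj i q j r ⟨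
        adj G (place i q) (place j r)                             ∎
      where open ≡-Reasoning

    model≺ : M ≺ G
    model≺ = embed , embed-injective , embed-adj

module _ {n : ℕ} (i : Fin n) (q : Fin (suc n)) where

  toℕ-combine′ : toℕ (combine i q) ≡ toℕ q + toℕ i * suc n
  toℕ-combine′ =
    trans (Finₚ.toℕ-combine i q) (trans (+-comm _ (toℕ q)) (cong (toℕ q +_) (*-comm (suc n) (toℕ i))))

  pos-combine : pos n (combine i q) ≡ toℕ q
  pos-combine = begin
    toℕ (combine i q) % suc n          ≡⟨ cong (_% suc n) toℕ-combine′ ⟩
    (toℕ q + toℕ i * suc n) % suc n    ≡⟨ [m+kn]%n≡m%n (toℕ q) (toℕ i) (suc n) ⟩
    toℕ q % suc n                      ≡⟨ m<n⇒m%n≡m (Finₚ.toℕ<n q) ⟩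
    toℕ q                              ∎
    where open ≡-Reasoning

  blk-combine : blk n (combine i q) ≡ toℕ i
  blk-combine = begin
    toℕ (combine i q) / suc n                ≡⟨ /-congˡ toℕ-combine′ ⟩
    (toℕ q + toℕ i * suc n) / suc n          ≡⟨ +-distrib-/-∣ʳ (toℕ q) (divides-refl (toℕ i)) ⟩
    toℕ q / suc n + toℕ i * suc n / suc n    ≡⟨ cong₂ _+_ (m<n⇒m/n≡0 (Finₚ.toℕ<n q)) (m*n/n≡m _ (suc n)) ⟩
    toℕ i                                    ∎
    where open ≡-Reasoning

≡ᵇ-toℕ : ∀ {n} (i j : Fin n) → (toℕ i ≡ᵇ toℕ j) ≡ does (i Fin.≟ j)
≡ᵇ-toℕ i j with i Fin.≟ j
... | yes refl = Equivalence.to T-≡ (≡⇒≡ᵇ (toℕ i) (toℕ i) refl)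
... | no i≢j   = ¬T⇒≡false (i≢j ∘ Finₚ.toℕ-injective ∘ ≡ᵇ⇒≡ (toℕ i) (toℕ j))

isCentre-toℕ : ∀ {n} (q : Fin (suc n)) → (toℕ q ≡ᵇ 0) ≡ isCentre q
isCentre-toℕ zero    = refl
isCentre-toℕ (suc _) = refl

combine-adj : ∀ {n} (F : Bool → Bool → Bool → Bool) (i : Fin n) q j r →
              F (blk n (combine i q) ≡ᵇ blk n (combine j r))
                (pos n (combine i q) ≡ᵇ 0) (pos n (combine j r) ≡ᵇ 0)
              ≡ F (does (i Fin.≟ j)) (isCentre q) (isCentre r)
combine-adj F i q j r
  rewrite blk-combine i q | blk-combine j r | pos-combine i q | pos-combine j r
        | ≡ᵇ-toℕ i j | isCentre-toℕ q | isCentre-toℕ r = refl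

module _ (n : ℕ) where

  combine-injective : ∀ {i j : Fin n} {q r : Fin (suc n)} → combine i q ≡ combine j r → i ≡ j × q ≡ r
  combine-injective {i} {j} {q} {r} e =
    Finₚ.combine-injectiveˡ i q j r e , Finₚ.combine-injectiveʳ i q j r e

  uncombine : ∀ (w : Fin (n * suc n)) → ∃₂ λ (i : Fin n) (q : Fin (suc n)) → combine i q ≡ w
  uncombine w = _ , _ , Finₚ.combine-remQuot {n} (suc n) w

  nK1n-model : StarsModel false n (nK1n n)
  nK1n-model = record
    { code           = combine
    ; code-injective = combine-injective
    ; decode         = uncombine
    ; adj-code       = λ i q j r →
        trans (combine-adj (λ e c c′ → e ∧ (c xor c′)) i q j r)
              (formula (does (i Fin.≟ j)) (isCentre q) (isCentre r))
    }
    where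
    formula : ∀ e c c′ → e ∧ (c xor c′) ≡ starsAdj false e c c′
    formula true  _     _     = refl
    formula false true  true  = refl
    formula false true  false = refl
    formula false false _     = refl

  Gn-model : StarsModel true n (Gn n)
  Gn-model = record
    { code           = combine
    ; code-injective = combine-injective
    ; decode         = uncombine
    ; adj-code       = λ i q j r →
        trans (combine-adj (λ e c c′ → ((c ∧ c′) ∧ not e) ∨ (e ∧ (c xor c′))) i q j r)
              (formula (does (i Fin.≟ j)) (isCentre q) (isCentre r))
    }
    where
    formula : ∀ e c c′ → ((c ∧ c′) ∧ not e) ∨ (e ∧ (c xor c′)) ≡ starsAdj true e c c′
    formula true  true  true  = refl
    formula true  true  false = refl
    formula true  false _     = refl
    formula false true  true  = refl
    formula false true  false = refl
    formula false false _     = refl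

module Classification (em : ExcludedMiddle 0ℓ) where

  open Counting em
  open CutVertex em

  module _ {G : Graph} {n : ℕ} (σ : Stars G n) where

    open Stars σ

    centre-sdeg : ∀ i → n ≤ sdeg G (centre i)
    centre-sdeg i = subst (_≤ sdeg G (centre i)) (length-tabulate (leaf i))
      (separated-neighbours≤sdeg G (centre i) (Allₚ.tabulate⁺ (centre-leaf i))
                                              (AllPairsₚ.tabulate⁺ (leaves-separated i)))

    stars⇒#bigSdeg : ∀ {k} → k ≤ n → n ≤ #bigSdeg G k
    stars⇒#bigSdeg {k} k≤n = begin
      n                            ≡⟨ length-tabulate centre ⟨
      length (tabulate centre)     ≤⟨ unique⇒length≤count {P = λ v → k ≤ sdeg G v}
                                        (Uniqueₚ.tabulate⁺ centre-injective)
                                        (Allₚ.tabulate⁺ (≤-trans k≤n ∘ centre-sdeg)) ⟩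
      count (λ v → k ≤ sdeg G v)  ≡⟨ length-filter-tabulate (λ v → k ≤? sdeg G v) id ⟨
      #bigSdeg G k                 ∎
      where open ≤-Reasoning

  -- The n + n separated neighbours of a centre lie in distinct components of G − centre, and each
  -- other centre lies in at most one of them: n neighbours remain whose components contain no centre.
  stars-from-centres : ∀ {G n} (centre : Fin n → Fin (V G)) → (∀ {i j} → centre i ≡ centre j → i ≡ j) →
                       (∀ i → n + n ≤ sdeg G (centre i)) → Stars G n
  stars-from-centres {G} {n} centre centre-injective big = record
    { centre                      = centre
    ; leaf                        = λ i → proj₁ (leaves i)
    ; centre-injective            = centre-injective
    ; centre-leaf                 = λ i p → proj₁ (proj₁ (proj₂ (leaves i)) p)
    ; leaves-separated            = λ i → proj₂ (proj₂ (leaves i))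
    ; leaf-separated-from-centres = λ i p j → All.lookup (proj₂ (proj₁ (proj₂ (leaves i)) p)) (∈-tabulate⁺ j)
    }
    where
    leaves : ∀ i → ∃ λ (leaf : Fin n → Fin (V G)) →
             (∀ p → Edge G (centre i) (leaf p) × All (Separated G (centre i) (leaf p)) (tabulate centre)) ×
             (∀ {p q} → p ≢ q → Separated G (centre i) (leaf p) (leaf q))
    leaves i =
      let v = centre i
          L₀ , ∣L₀∣ , adj₀ , sep₀          = separated-neighbours G v
          L₁ , bound , adj₁ , sep₁ , miss₁ =
            keep-missing (WalkAvoiding G v) (λ x∤y x↝t y↝t → x∤y (x↝t ◅◅ avoiding-reverse G v y↝t))
                         (tabulate centre) L₀ adj₀ sep₀
          n≤∣L₁∣ = +-cancelˡ-≤ n n (length L₁) (begin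
            n + n                                ≤⟨ big i ⟩
            sdeg G v                             ≡⟨ ∣L₀∣ ⟨
            length L₀                            ≤⟨ bound ⟩
            length (tabulate centre) + length L₁ ≡⟨ cong (_+ length L₁) (length-tabulate centre) ⟩
            n + length L₁                        ∎)
      in  AllPairs⇒family (λ x∤y → x∤y ∘ avoiding-reverse G v) L₁ n≤∣L₁∣ (All.zip (adj₁ , miss₁)) sep₁
      where open ≤-Reasoning

  bigVertices : (G : Graph) → ℕ → List (Fin (V G))
  bigVertices G k = filter (λ v → k ≤? sdeg G v) (allFin (V G))

  monochromatic⇒≺ : ∀ {κ n M G} → StarsModel κ n M →
                    MonochromaticSublist (adj G) κ n (bigVertices G (n + n)) → M ≺ G
  monochromatic⇒≺ {κ} {n} {G = G} model (ys , ys⊆ , ∣ys∣ , mono) =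
    let centre , big , apart = centres
    in  StarsModel.model≺ model (stars-from-centres centre (injective (proj₁ ∘ apart)) big) (proj₂ ∘ apart)
    where
    DistinctColoured : Rel (Fin (V G)) 0ℓ
    DistinctColoured x y = x ≢ y × adj G x y ≡ κ

    DistinctColoured-sym : Symmetric DistinctColoured
    DistinctColoured-sym (x≢y , xy≡κ) = x≢y ∘ sym , trans (Graph.sym G _ _) xy≡κ

    centres : ∃ λ (centre : Fin n → Fin (V G)) → (∀ i → n + n ≤ sdeg G (centre i)) ×
                                                  (∀ {i j} → i ≢ j → DistinctColoured (centre i) (centre j))
    centres = AllPairs⇒family DistinctColoured-sym ys (≤-reflexive (sym ∣ys∣))
                (Sublistₚ.All-resp-⊆ ys⊆ (Allₚ.all-filter _ (allFin (V G))))
                (AllPairs.zip (AllPairs-resp-⊆ ys⊆ (Uniqueₚ.filter⁺ _ (Uniqueₚ.allFin⁺ (V G))) , mono))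

    injective : {f : Fin n → Fin (V G)} → (∀ {i j} → i ≢ j → f i ≢ f j) → ∀ {i j} → f i ≡ f j → i ≡ j
    injective f-distinct {i} {j} e with i Fin.≟ j
    ... | yes i≡j = i≡j
    ... | no i≢j  = contradiction e (f-distinct i≢j)

  ¬free⇒contains : ∀ 𝓗 G → ¬ (𝓗 -free) G → ∃ λ H → 𝓗 H × H ≺ G
  ¬free⇒contains 𝓗 G not-free with em {∃ λ H → 𝓗 H × H ≺ G}
  ... | yes found = found
  ... | no none   = ⊥-elim (not-free λ H 𝓗H H≺G → none (H , 𝓗H , H≺G))

  bounded⇒≤fam : ∀ 𝓗 → (∃₂ λ c₁ c₂ → ∀ G → (𝓗 -free) G → #bigSdeg G c₁ < c₂) → ∃ λ n → 1 ≤ n × 𝓗 ≤fam[ n ]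
  bounded⇒≤fam 𝓗 (c₁ , c₂ , bounded) = N , s≤s z≤n , contained (nK1n-model N) , contained (Gn-model N)
    where
    N : ℕ
    N = suc (c₁ + c₂)

    contained : ∀ {κ M} → StarsModel κ N M → ∃ λ H → 𝓗 H × H ≺ M
    contained {M = M} model = ¬free⇒contains 𝓗 M λ free → <⇒≱ (bounded M free) (begin
      c₂                 ≤⟨ m≤n+m c₂ (suc c₁) ⟩
      N                  ≤⟨ stars⇒#bigSdeg (StarsModel.stars model) (≤-trans (m≤m+n c₁ c₂) (n≤1+n _)) ⟩
      #bigSdeg M c₁      ∎)
      where open ≤-Reasoning

  ≤fam⇒bounded : ∀ 𝓗 → (∃ λ n → 1 ≤ n × 𝓗 ≤fam[ n ]) → ∃₂ λ c₁ c₂ → ∀ G → (𝓗 -free) G → #bigSdeg G c₁ < c₂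
  ≤fam⇒bounded 𝓗 (n , _ , (H₁ , 𝓗H₁ , H₁≺nK1n) , (H₂ , 𝓗H₂ , H₂≺Gn)) = n + n , ramseyBound n n , bounded
    where
    bounded : ∀ G → (𝓗 -free) G → #bigSdeg G (n + n) < ramseyBound n n
    bounded G free = ≰⇒> λ R≤#big → case ramsey (adj G) n n (bigVertices G (n + n)) R≤#big of λ where
      (inj₁ clique)      → free H₂ 𝓗H₂ (≺-trans {H₂} {Gn n} {G} H₂≺Gn (monochromatic⇒≺ (Gn-model n) clique))
      (inj₂ independent) → free H₁ 𝓗H₁ (≺-trans {H₁} {nK1n n} {G} H₁≺nK1n
                                                   (monochromatic⇒≺ (nK1n-model n) independent))

theorem1p16 : ExcludedMiddle 0ℓ → (𝓗 : Family) →
    (∃₂ λ c₁ c₂ → ∀ G → (𝓗 -free) G → #bigSdeg G c₁ < c₂)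
    ⇔ (∃ λ n → 1 ≤ n × 𝓗 ≤fam[ n ])
theorem1p16 em 𝓗 = mk⇔ (bounded⇒≤fam 𝓗) (≤fam⇒bounded 𝓗)
  where open Classification em
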